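{- (Subject-reduction.) Let $\equiv$ be a non-confusing congruence on types, let $\Gamma$ be a context, $A$ a type and $t$, $u$ schemes. If $\Gamma \vdash t : A$ and $t_{\Gamma} \rhd^* u_{\Gamma}$, then $\Gamma \vdash u : A$.
   Context: Fix a many-sorted first-order language: a set of sorts, function symbols with arities $\langle s_1,\ldots,s_n,s\rangle$, predicate symbols with arities $\langle s_1,\ldots,s_n\rangle$, and infinitely many variables of each sort. Terms of sort $s$: $a ::= x \mid f(a_1,\ldots,a_n)$ (sort-respecting). Types (propositions): $A ::= P(a_1,\ldots,a_n) \mid A \Rightarrow A' \mid \forall x\, A$, with the usual free/bound variables, $\alpha$-equivalence and capture-avoiding substitution $[a/x]$ on terms and types. A context is a finite SET of types (so $\Gamma\cup\{A\}=\Gamma$ when $A\in\Gamma$). A congruence $\equiv$ on types is fixed; it is non-confusing: if $A\equiv B$ then either at least one of $A,B$ is atomic, or both are implications, or both are universal quantifications; if $(A\Rightarrow A')\equiv(B\Rightarrow B')$ then $A\equiv B$ and $A'\equiv B'$; if $(\forall x\,A)\equiv(\forall x\,B)$ then $A\equiv B$. Schemes: $t ::= \mathbf{v}_A \mid \lambda_A t \mid (t\ t') \mid \Lambda x\, t \mid (t\ a)$, where $\mathbf{v}_A$ is the (unique, canonical) variable of type $A$ and $a$ is a term. Typing rules for $\Gamma\vdash t:A$: (ax) $\Gamma\vdash \mathbf{v}_A:A$ if $A\in\Gamma$; ($\Rightarrow$i) from $\Gamma\cup\{A\}\vdash t:B$ infer $\Gamma\vdash\lambda_A t:A\Rightarrow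 B$; ($\Rightarrow$e) from $\Gamma\vdash t:A\Rightarrow B$ and $\Gamma\vdash u:A$ infer $\Gamma\vdash(t\ u):B$; ($\forall$i) from $\Gamma\vdash t:A$ infer $\Gamma\vdash\Lambda x\,t:\forall x\,A$ provided $x$ is not free in $\Gamma$; ($\forall$e) from $\Gamma\vdash t:\forall x\,A$ infer $\Gamma\vdash(t\ a):[a/x]A$; (conv) from $\Gamma\vdash t:A$ infer $\Gamma\vdash t:B$ if $A\equiv B$. A scheme in context $t_\Gamma$ is a pair of a scheme $t$ and a context $\Gamma$ in which $t$ is well-typed. Substitution of term variables in schemes: $\theta\mathbf{v}_A=\mathbf{v}_{\theta A}$, $\theta(\lambda_A t)=\lambda_{\theta A}\theta t$, $\theta(u\ v)=(\theta u\ \theta v)$, $\theta(\Lambda x\,t)=\Lambda x'\,\theta([x'/x]t)$ with $x'$ fresh, $\theta(t\ a)=(\theta t\ \theta a)$. A scheme substitution $\sigma=[t_1/A_1,\ldots,t_n/A_n]$ is a finite map from types to schemes; its application to a scheme $t$ w.r.t. a context $\Gamma$ is a SET $\sigma_\Gamma t$ of schemes: $\sigma_\Gamma\mathbf{v}_A=\{\mathbf{v}_A,\sigma(A)\}$ if $A\in dom(\sigma)$ and $A\in\Gamma$; $\sigma_\Gamma\mathbf{v}_A=\{\sigma(A)\}$ if $A\in dom(\sigma)$ and $A\notin\Gamma$; $\sigma_\Gamma\mathbf{v}_A=\{\mathbf{v}_A\}$ if $A\notin dom(\sigma)$; $\sigma_\Gamma(\lambda_A t)=\lambda_A\,\sigma_{\Gamma\cup\{A\}}t$;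 $\sigma_\Gamma(u\ v)=(\sigma_\Gamma u\ \sigma_\Gamma v)$; $\sigma_\Gamma(\Lambda x\,t)=\Lambda x'\,\sigma_\Gamma([x'/x]t)$ with $x'$ occurring neither in $\Lambda x\,t$ nor in $\sigma$; $\sigma_\Gamma(t\ a)=(\sigma_\Gamma t\ a)$. Here for sets $S,S'$ of schemes, $\lambda_A S=\{\lambda_A t: t\in S\}$, $(S\ S')=\{(t\ t'):t\in S,t'\in S'\}$, etc. Reduction: top-level $((\lambda_A t)\ u)_\Gamma\longrightarrow v_\Gamma$ for every $v\in[u/A]_\Gamma t$, and $((\Lambda x\,t)\ a)_\Gamma\longrightarrow([a/x]t)_\Gamma$. One-step reduction $\rhd$ is the contextual closure: if $t_\Gamma\longrightarrow t'_\Gamma$ then $t_\Gamma\rhd t'_\Gamma$; if $t_\Gamma\rhd t'_\Gamma$ then $(t\ u)_\Gamma\rhd(t'\ u)_\Gamma$, $(t\ a)_\Gamma\rhd(t'\ a)_\Gamma$ and $(\Lambda x\,t)_\Gamma\rhd(\Lambda x\,t')_\Gamma$; if $u_\Gamma\rhd u'_\Gamma$ then $(t\ u)_\Gamma\rhd(t\ u')_\Gamma$; if $t_{\Gamma\cup\{A\}}\rhd t'_{\Gamma\cup\{A\}}$ then $(\lambda_A t)_\Gamma\rhd(\lambda_A t')_\Gamma$. $\rhd^*$ is the reflexive-transitive closure of $\rhd$. -}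

module Defs where

open import Level using (0ℓ)
open import Data.Nat using (ℕ; _<_; _≟_)
open import Data.Product using (Σ; _×_; _,_; ∃)
open import Data.Sum using (_⊎_)
open import Data.List using (List; []; _∷_; [_])
open import Data.List.Membership.Propositional using (_∈_)
open import Data.List.Relation.Unary.Any using (Any; here; there)
open import Relation.Binary.PropositionalEquality using (_≡_; refl)
open import Relation.Binary.Core using (Rel)
open import Relation.Nullary using (¬_; yes; no)
open import Relation.Binary.Construct.Closure.ReflexiveTransitive using (Star)

record Language : Set₁ where
  field
    Sort      : Set
    Fun       : Set
    funArgs   : Fun → List Sort
    funSort   : Fun → Sort
    Pred      : Set
    predArgs  : Pred → List Sort
    sortOf    : ℕ → Sort
    infVars   : ∀ (s : Sort) (n : ℕ) → Σ ℕ λ m → (n < m) × (sortOf m ≡ s)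

module Lang (L : Language) where
  open Language L public

  -- Syntax in locally-nameless style (so that alpha-equivalent objects
  -- are syntactically equal): free variables are names x : ℕ, bound
  -- variables are (well-scoped, sorted) de Bruijn indices; Δ is the
  -- list of sorts of the bound variables in scope.

  mutual
    data Term (Δ : List Sort) : Sort → Set where
      bv  : ∀ {s} → s ∈ Δ → Term Δ s
      fv  : (x : ℕ) → Term Δ (sortOf x)
      fun : (f : Fun) → Terms Δ (funArgs f) → Term Δ (funSort f)

    data Terms (Δ : List Sort) : List Sort → Set where
      []  : Terms Δ []
      _∷_ : ∀ {s ss} → Term Δ s → Terms Δ ss → Terms Δ (s ∷ ss)

  data Type (Δ : List Sort) : Set where
    atom : (P : Pred) → Terms Δ (predArgs P) → Type Δ
    _⇒_  : Type Δ → Type Δ → Type Δ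
    all  : (s : Sort) → Type (s ∷ Δ) → Type Δ

  data Scheme (Δ : List Sort) : Set where
    var  : Type Δ → Scheme Δ
    lam  : Type Δ → Scheme Δ → Scheme Δ
    app  : Scheme Δ → Scheme Δ → Scheme Δ
    Lam  : (s : Sort) → Scheme (s ∷ Δ) → Scheme Δ
    tapp : ∀ {s} → Scheme Δ → Term Δ s → Scheme Δ

  Ren : List Sort → List Sort → Set
  Ren Δ Δ' = ∀ {s} → s ∈ Δ → s ∈ Δ'

  Env : List Sort → List Sort → Set
  Env Δ Δ' = ∀ {s} → s ∈ Δ → Term Δ' s

  mutual
    renTm : ∀ {Δ Δ' s} → Ren Δ Δ' → Term Δ s → Term Δ' s
    renTm ρ (bv i)     = bv (ρ i)
    renTm ρ (fv x)     = fv x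
    renTm ρ (fun f as) = fun f (renTms ρ as)

    renTms : ∀ {Δ Δ' ss} → Ren Δ Δ' → Terms Δ ss → Terms Δ' ss
    renTms ρ []       = []
    renTms ρ (a ∷ as) = renTm ρ a ∷ renTms ρ as

  wk : ∀ {Δ r s} → Term Δ s → Term (r ∷ Δ) s
  wk = renTm there

  ext : ∀ {Δ Δ' r} → Env Δ Δ' → Env (r ∷ Δ) (r ∷ Δ')
  ext σ (here p)  = bv (here p)
  ext σ (there i) = wk (σ i)

  mutual
    subTm : ∀ {Δ Δ' s} → Env Δ Δ' → Term Δ s → Term Δ' s
    subTm σ (bv i)     = σ i
    subTm σ (fv x)     = fv x
    subTm σ (fun f as) = fun f (subTms σ as)

    subTms : ∀ {Δ Δ' ss} → Env Δ Δ' → Terms Δ ss → Terms Δ' ss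
    subTms σ []       = []
    subTms σ (a ∷ as) = subTm σ a ∷ subTms σ as

  subTy : ∀ {Δ Δ'} → Env Δ Δ' → Type Δ → Type Δ'
  subTy σ (atom P as) = atom P (subTms σ as)
  subTy σ (A ⇒ B)     = subTy σ A ⇒ subTy σ B
  subTy σ (all s A)   = all s (subTy (ext σ) A)

  subSc : ∀ {Δ Δ'} → Env Δ Δ' → Scheme Δ → Scheme Δ'
  subSc σ (var A)    = var (subTy σ A)
  subSc σ (lam A t)  = lam (subTy σ A) (subSc σ t)
  subSc σ (app t u)  = app (subSc σ t) (subSc σ u)
  subSc σ (Lam s t)  = Lam s (subSc (ext σ) t)
  subSc σ (tapp t a) = tapp (subSc σ t) (subTm σ a)

  inst₀ : ∀ {Δ s} → Term Δ s → Env (s ∷ Δ) Δ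
  inst₀ a (here refl) = a
  inst₀ a (there i)   = bv i

  instTy : ∀ {Δ s} → Term Δ s → Type (s ∷ Δ) → Type Δ
  instTy a = subTy (inst₀ a)

  instSc : ∀ {Δ s} → Term Δ s → Scheme (s ∷ Δ) → Scheme Δ
  instSc a = subSc (inst₀ a)

  openTy : ∀ {Δ} (x : ℕ) → Type (sortOf x ∷ Δ) → Type Δ
  openTy x = instTy (fv x)

  openSc : ∀ {Δ} (x : ℕ) → Scheme (sortOf x ∷ Δ) → Scheme Δ
  openSc x = instSc (fv x)

  mutual
    fsubTm : ∀ {Δ s} (x : ℕ) → Term [] (sortOf x) → Term Δ s → Term Δ s
    fsubTm x a (bv i) = bv i
    fsubTm x a (fv y) with x ≟ y
    ... | yes refl = renTm (λ ()) a
    ... | no  _    = fv y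
    fsubTm x a (fun f as) = fun f (fsubTms x a as)

    fsubTms : ∀ {Δ ss} (x : ℕ) → Term [] (sortOf x) → Terms Δ ss → Terms Δ ss
    fsubTms x a []       = []
    fsubTms x a (b ∷ bs) = fsubTm x a b ∷ fsubTms x a bs

  fsubTy : ∀ {Δ} (x : ℕ) → Term [] (sortOf x) → Type Δ → Type Δ
  fsubTy x a (atom P as) = atom P (fsubTms x a as)
  fsubTy x a (A ⇒ B)     = fsubTy x a A ⇒ fsubTy x a B
  fsubTy x a (all s A)   = all s (fsubTy x a A)

  mutual
    data OccTm (x : ℕ) {Δ} : ∀ {s} → Term Δ s → Set where
      fv-here : OccTm x (fv x)
      fun-arg : ∀ {f as} → OccTms x as → OccTm x (fun f as)

    data OccTms (x : ℕ) {Δ} : ∀ {ss} → Terms Δ ss → Set where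
      head : ∀ {s ss} {a : Term Δ s} {as : Terms Δ ss} → OccTm x a → OccTms x (a ∷ as)
      tail : ∀ {s ss} {a : Term Δ s} {as : Terms Δ ss} → OccTms x as → OccTms x (a ∷ as)

  data OccTy (x : ℕ) : ∀ {Δ} → Type Δ → Set where
    atom-arg : ∀ {Δ P} {as : Terms Δ (predArgs P)} → OccTms x as → OccTy x (atom P as)
    imp-l    : ∀ {Δ} {A B : Type Δ} → OccTy x A → OccTy x (A ⇒ B)
    imp-r    : ∀ {Δ} {A B : Type Δ} → OccTy x B → OccTy x (A ⇒ B)
    all-body : ∀ {Δ s} {A : Type (s ∷ Δ)} → OccTy x A → OccTy x (all s A)

  data OccSc (x : ℕ) : ∀ {Δ} → Scheme Δ → Set where
    var-ty   : ∀ {Δ} {A : Type Δ} → OccTy x A → OccSc x (var A)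
    lam-ty   : ∀ {Δ} {A : Type Δ} {t} → OccTy x A → OccSc x (lam A t)
    lam-body : ∀ {Δ} {A : Type Δ} {t} → OccSc x t → OccSc x (lam A t)
    app-l    : ∀ {Δ} {t u : Scheme Δ} → OccSc x t → OccSc x (app t u)
    app-r    : ∀ {Δ} {t u : Scheme Δ} → OccSc x u → OccSc x (app t u)
    Lam-body : ∀ {Δ s} {t : Scheme (s ∷ Δ)} → OccSc x t → OccSc x (Lam s t)
    tapp-l   : ∀ {Δ s} {t : Scheme Δ} {a : Term Δ s} → OccSc x t → OccSc x (tapp t a)
    tapp-r   : ∀ {Δ s} {t : Scheme Δ} {a : Term Δ s} → OccTm x a → OccSc x (tapp t a)

  Prop : Set
  Prop = Type []

  Sch : Set
  Sch = Scheme []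

  -- contexts: finite sets of types, represented by lists
  -- (only membership is ever used); Γ ∪ {A} is  A ∷ Γ
  Context : Set
  Context = List Prop

  FreeIn : ℕ → Context → Set
  FreeIn x Γ = Any (OccTy x) Γ

  record IsCongruence (_≈_ : Rel Prop 0ℓ) : Set where
    field
      refl≈  : ∀ {A} → A ≈ A
      sym≈   : ∀ {A B} → A ≈ B → B ≈ A
      trans≈ : ∀ {A B C} → A ≈ B → B ≈ C → A ≈ C
      imp≈   : ∀ {A A' B B'} → A ≈ B → A' ≈ B' → (A ⇒ A') ≈ (B ⇒ B')
      all≈   : ∀ (x : ℕ) {A B : Type (sortOf x ∷ [])} →
               ¬ OccTy x (all (sortOf x) A) → ¬ OccTy x (all (sortOf x) B) →
               openTy x A ≈ openTy x B → all (sortOf x) A ≈ all (sortOf x) B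
      subst≈ : ∀ (x : ℕ) (a : Term [] (sortOf x)) {A B} →
               A ≈ B → fsubTy x a A ≈ fsubTy x a B

  data IsAtomic : Prop → Set where
    atomic : ∀ P as → IsAtomic (atom P as)

  data BothImp : Prop → Prop → Set where
    bothImp : ∀ A A' B B' → BothImp (A ⇒ A') (B ⇒ B')

  data BothAll : Prop → Prop → Set where
    bothAll : ∀ s s' A B → BothAll (all s A) (all s' B)

  record NonConfusing (_≈_ : Rel Prop 0ℓ) : Set where
    field
      shape : ∀ {A B} → A ≈ B →
              IsAtomic A ⊎ IsAtomic B ⊎ BothImp A B ⊎ BothAll A B
      imp-inv : ∀ {A A' B B'} → (A ⇒ A') ≈ (B ⇒ B') → (A ≈ B) × (A' ≈ B')
      all-inv : ∀ (x : ℕ) {A B : Type (sortOf x ∷ [])} →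
                ¬ OccTy x (all (sortOf x) A) → ¬ OccTy x (all (sortOf x) B) →
                all (sortOf x) A ≈ all (sortOf x) B → openTy x A ≈ openTy x B

  module Typing (_≈_ : Rel Prop 0ℓ) where

    infix 4 _⊢_∶_
    data _⊢_∶_ (Γ : Context) : Sch → Prop → Set where
      ax   : ∀ {A} → A ∈ Γ → Γ ⊢ var A ∶ A
      ⇒i   : ∀ {A B t} → (A ∷ Γ) ⊢ t ∶ B → Γ ⊢ lam A t ∶ (A ⇒ B)
      ⇒e   : ∀ {A B t u} → Γ ⊢ t ∶ (A ⇒ B) → Γ ⊢ u ∶ A → Γ ⊢ app t u ∶ B
      ∀i   : ∀ (x : ℕ) {b : Scheme (sortOf x ∷ [])} {B : Type (sortOf x ∷ [])} →
             ¬ FreeIn x Γ → ¬ OccSc x (Lam (sortOf x) b) → ¬ OccTy x (all (sortOf x) B) →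
             Γ ⊢ openSc x b ∶ openTy x B →
             Γ ⊢ Lam (sortOf x) b ∶ all (sortOf x) B
      ∀e   : ∀ {s t} {B : Type (s ∷ [])} → Γ ⊢ t ∶ all s B →
             (a : Term [] s) → Γ ⊢ tapp t a ∶ instTy a B
      conv : ∀ {t A B} → Γ ⊢ t ∶ A → A ≈ B → Γ ⊢ t ∶ B

  -- Scheme substitutions  σ = [t₁/A₁, …, tₙ/Aₙ]  (a list of pairs; σ(A) = t
  -- means (A , t) ∈ σ) and their set-valued application:
  --   SubstIn σ Γ t v   means   v ∈ σ_Γ t

  SchSubst : Set
  SchSubst = List (Prop × Sch)

  OccSubst : ℕ → SchSubst → Set
  OccSubst x σ = Any (λ p → OccTy x (Data.Product.proj₁ p) ⊎ OccSc x (Data.Product.proj₂ p)) σ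

  data SubstIn (σ : SchSubst) : Context → Sch → Sch → Set where
    var-keep  : ∀ {Γ A t} → (A , t) ∈ σ → A ∈ Γ → SubstIn σ Γ (var A) (var A)
    var-repl  : ∀ {Γ A t} → (A , t) ∈ σ → SubstIn σ Γ (var A) t
    var-nodom : ∀ {Γ A} → (∀ t → ¬ ((A , t) ∈ σ)) → SubstIn σ Γ (var A) (var A)
    lam       : ∀ {Γ A t t'} → SubstIn σ (A ∷ Γ) t t' → SubstIn σ Γ (lam A t) (lam A t')
    app       : ∀ {Γ t t' u u'} → SubstIn σ Γ t t' → SubstIn σ Γ u u' →
                SubstIn σ Γ (app t u) (app t' u')
    Lam       : ∀ {Γ} (x : ℕ) {b b' : Scheme (sortOf x ∷ [])} →
                ¬ OccSc x (Lam (sortOf x) b) → ¬ OccSubst x σ → ¬ OccSc x (Lam (sortOf x) b') →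
                SubstIn σ Γ (openSc x b) (openSc x b') →
                SubstIn σ Γ (Lam (sortOf x) b) (Lam (sortOf x) b')
    tapp      : ∀ {Γ t t' s} {a : Term [] s} → SubstIn σ Γ t t' →
                SubstIn σ Γ (tapp t a) (tapp t' a)

  infix 4 _⊢_⟶_ _⊢_▷_ _⊢_▷*_

  data _⊢_⟶_ (Γ : Context) : Sch → Sch → Set where
    β⇒ : ∀ {A t u v} → SubstIn [ (A , u) ] Γ t v → Γ ⊢ app (lam A t) u ⟶ v
    β∀ : ∀ {s} {b : Scheme (s ∷ [])} {a : Term [] s} →
         Γ ⊢ tapp (Lam s b) a ⟶ instSc a b

  data _⊢_▷_ : Context → Sch → Sch → Set where
    top    : ∀ {Γ t t'} → Γ ⊢ t ⟶ t' → Γ ⊢ t ▷ t'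
    appL   : ∀ {Γ t t' u} → Γ ⊢ t ▷ t' → Γ ⊢ app t u ▷ app t' u
    tappL  : ∀ {Γ t t' s} {a : Term [] s} → Γ ⊢ t ▷ t' → Γ ⊢ tapp t a ▷ tapp t' a
    -- (Λx t)_Γ ▷ (Λx t')_Γ  if  t_Γ ▷ t'_Γ, the bound name x chosen
    -- not free in Γ (Barendregt convention), and x not in b, b'
    LamC   : ∀ {Γ} (x : ℕ) {b b' : Scheme (sortOf x ∷ [])} →
             ¬ FreeIn x Γ → ¬ OccSc x (Lam (sortOf x) b) → ¬ OccSc x (Lam (sortOf x) b') →
             Γ ⊢ openSc x b ▷ openSc x b' →
             Γ ⊢ Lam (sortOf x) b ▷ Lam (sortOf x) b'
    appR   : ∀ {Γ t u u'} → Γ ⊢ u ▷ u' → Γ ⊢ app t u ▷ app t u'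
    lamC   : ∀ {Γ A t t'} → (A ∷ Γ) ⊢ t ▷ t' → Γ ⊢ lam A t ▷ lam A t'

  _⊢_▷*_ : Context → Sch → Sch → Set
  Γ ⊢ t ▷* u = Star (Γ ⊢_▷_) t u

module Submission where

-- By induction on the typing derivation, a one-step reduct of θ t has type θ A, for every
-- substitution θ of closed terms for names that has finite support and preserves ≡.  This
-- generality is forced by the Λ-case: the rule ∀i and the reduction under Λ may open the bound
-- variable with different names x and y.  Both are moved to a name z fresh for everything: the
-- reduction by swapping y and z (reduction is equivariant under swaps), the derivation by
-- θ ⊙ (x ↦ z).  The β⇒-step needs the analogous statement for scheme substitution, where
-- non-confusion splits (C ⇒ B') ≡ (A ⇒ B); in the β∀-step non-confusion turns ∀x A ≡ ∀x B into
-- A ≡ B at a fresh name, and stability of ≡ under term substitution carries this to every instance.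

open import Defs
open import Data.Empty using (⊥-elim)
open import Data.List using (List; []; _∷_; [_]; map)
open import Data.List.Extrema.Nat using (max; xs≤max)
open import Data.List.Membership.Propositional using (_∈_; lose)
open import Data.List.Relation.Unary.All as All using (All; []; _∷_)
open import Data.List.Relation.Unary.Any using (here; there)
open import Data.Nat using (ℕ; _≤_; _<_; _⊔_; _≟_)
open import Data.Nat.Properties
  using (≤-refl; ≤-reflexive; ≤-<-trans; <⇒≱; m≤m⊔n; m≤n⊔m; m≤n⇒m≤n⊔o; m≤n⇒m≤o⊔n)
open import Data.Product as Prod using (Σ; _×_; _,_; proj₁)
open import Data.Sum as Sum using (_⊎_; inj₁; inj₂)
open import Data.List.Membership.Propositional.Properties using (∈-map⁺; ∈-map⁻)
open import Function using (_∘_)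
open import Relation.Binary.PropositionalEquality
  using (_≡_; _≢_; refl; sym; trans; cong; cong₂; subst; subst₂)
open import Relation.Nullary using (¬_; yes; no)
open import Relation.Binary.Construct.Closure.ReflexiveTransitive using (ε; _◅_)

module Syntax (L : Language) where
  open Lang L

  close : ∀ {Δ s} → Term [] s → Term Δ s
  close = renTm (λ ())

  mutual
    renTm-closed : ∀ {Δ Δ' s} (ρ₀ : Ren [] Δ) (ρ : Ren Δ Δ') (ρ₁ : Ren [] Δ') (c : Term [] s) →
                   renTm ρ (renTm ρ₀ c) ≡ renTm ρ₁ c
    renTm-closed ρ₀ ρ ρ₁ (bv ())
    renTm-closed ρ₀ ρ ρ₁ (fv x)     = refl
    renTm-closed ρ₀ ρ ρ₁ (fun f cs) = cong (fun f) (renTms-closed ρ₀ ρ ρ₁ cs)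

    renTms-closed : ∀ {Δ Δ' ss} (ρ₀ : Ren [] Δ) (ρ : Ren Δ Δ') (ρ₁ : Ren [] Δ') (cs : Terms [] ss) →
                    renTms ρ (renTms ρ₀ cs) ≡ renTms ρ₁ cs
    renTms-closed ρ₀ ρ ρ₁ []       = refl
    renTms-closed ρ₀ ρ ρ₁ (c ∷ cs) =
      cong₂ _∷_ (renTm-closed ρ₀ ρ ρ₁ c) (renTms-closed ρ₀ ρ ρ₁ cs)

  mutual
    subTm-closed : ∀ {Δ Δ' s} (ρ₀ : Ren [] Δ) (σ : Env Δ Δ') (ρ₁ : Ren [] Δ') (c : Term [] s) →
                   subTm σ (renTm ρ₀ c) ≡ renTm ρ₁ c
    subTm-closed ρ₀ σ ρ₁ (bv ())
    subTm-closed ρ₀ σ ρ₁ (fv x)     = refl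
    subTm-closed ρ₀ σ ρ₁ (fun f cs) = cong (fun f) (subTms-closed ρ₀ σ ρ₁ cs)

    subTms-closed : ∀ {Δ Δ' ss} (ρ₀ : Ren [] Δ) (σ : Env Δ Δ') (ρ₁ : Ren [] Δ') (cs : Terms [] ss) →
                    subTms σ (renTms ρ₀ cs) ≡ renTms ρ₁ cs
    subTms-closed ρ₀ σ ρ₁ []       = refl
    subTms-closed ρ₀ σ ρ₁ (c ∷ cs) =
      cong₂ _∷_ (subTm-closed ρ₀ σ ρ₁ c) (subTms-closed ρ₀ σ ρ₁ cs)

  mutual
    renTm-closed-id : ∀ {s} (ρ : Ren [] []) (c : Term [] s) → renTm ρ c ≡ c
    renTm-closed-id ρ (bv ())
    renTm-closed-id ρ (fv x)     = refl
    renTm-closed-id ρ (fun f cs) = cong (fun f) (renTms-closed-id ρ cs)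

    renTms-closed-id : ∀ {ss} (ρ : Ren [] []) (cs : Terms [] ss) → renTms ρ cs ≡ cs
    renTms-closed-id ρ []       = refl
    renTms-closed-id ρ (c ∷ cs) = cong₂ _∷_ (renTm-closed-id ρ c) (renTms-closed-id ρ cs)

  NameSubst : Set
  NameSubst = (x : ℕ) → Term [] (sortOf x)

  mutual
    nsubTm : ∀ {Δ s} → NameSubst → Term Δ s → Term Δ s
    nsubTm θ (bv i)     = bv i
    nsubTm θ (fv x)     = close (θ x)
    nsubTm θ (fun f as) = fun f (nsubTms θ as)

    nsubTms : ∀ {Δ ss} → NameSubst → Terms Δ ss → Terms Δ ss
    nsubTms θ []       = []
    nsubTms θ (a ∷ as) = nsubTm θ a ∷ nsubTms θ as

  nsubTy : ∀ {Δ} → NameSubst → Type Δ → Type Δ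
  nsubTy θ (atom P as) = atom P (nsubTms θ as)
  nsubTy θ (A ⇒ B)     = nsubTy θ A ⇒ nsubTy θ B
  nsubTy θ (all s A)   = all s (nsubTy θ A)

  nsubSc : ∀ {Δ} → NameSubst → Scheme Δ → Scheme Δ
  nsubSc θ (var A)    = var (nsubTy θ A)
  nsubSc θ (lam A t)  = lam (nsubTy θ A) (nsubSc θ t)
  nsubSc θ (app t u)  = app (nsubSc θ t) (nsubSc θ u)
  nsubSc θ (Lam s t)  = Lam s (nsubSc θ t)
  nsubSc θ (tapp t a) = tapp (nsubSc θ t) (nsubTm θ a)

  nsubCtx : NameSubst → Context → Context
  nsubCtx θ = map (nsubTy θ)

  idₙ : NameSubst
  idₙ x = fv x

  _⊙_ : NameSubst → NameSubst → NameSubst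
  (θ ⊙ θ') x = nsubTm θ (θ' x)

  mutual
    nsubTm-renTm : ∀ θ {Δ Δ' s} (ρ : Ren Δ Δ') (a : Term Δ s) →
                   nsubTm θ (renTm ρ a) ≡ renTm ρ (nsubTm θ a)
    nsubTm-renTm θ ρ (bv i)     = refl
    nsubTm-renTm θ ρ (fv x)     = sym (renTm-closed _ ρ _ (θ x))
    nsubTm-renTm θ ρ (fun f as) = cong (fun f) (nsubTms-renTms θ ρ as)

    nsubTms-renTms : ∀ θ {Δ Δ' ss} (ρ : Ren Δ Δ') (as : Terms Δ ss) →
                     nsubTms θ (renTms ρ as) ≡ renTms ρ (nsubTms θ as)
    nsubTms-renTms θ ρ []       = refl
    nsubTms-renTms θ ρ (a ∷ as) = cong₂ _∷_ (nsubTm-renTm θ ρ a) (nsubTms-renTms θ ρ as)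

  _≗ᴱ_ : ∀ {Δ Δ'} → Env Δ Δ' → Env Δ Δ' → Set
  _≗ᴱ_ {Δ} σ σ' = ∀ {r} (i : r ∈ Δ) → σ i ≡ σ' i

  ext-≗ᴱ : ∀ {Δ Δ' r} {σ σ' : Env Δ Δ'} → σ ≗ᴱ σ' → ext {r = r} σ ≗ᴱ ext σ'
  ext-≗ᴱ eq (here p)  = refl
  ext-≗ᴱ eq (there i) = cong wk (eq i)

  mutual
    subTm-≗ᴱ : ∀ {Δ Δ' s} {σ σ' : Env Δ Δ'} → σ ≗ᴱ σ' → (a : Term Δ s) → subTm σ a ≡ subTm σ' a
    subTm-≗ᴱ eq (bv i)     = eq i
    subTm-≗ᴱ eq (fv x)     = refl
    subTm-≗ᴱ eq (fun f as) = cong (fun f) (subTms-≗ᴱ eq as)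

    subTms-≗ᴱ : ∀ {Δ Δ' ss} {σ σ' : Env Δ Δ'} → σ ≗ᴱ σ' → (as : Terms Δ ss) →
                subTms σ as ≡ subTms σ' as
    subTms-≗ᴱ eq []       = refl
    subTms-≗ᴱ eq (a ∷ as) = cong₂ _∷_ (subTm-≗ᴱ eq a) (subTms-≗ᴱ eq as)

  subTy-≗ᴱ : ∀ {Δ Δ'} {σ σ' : Env Δ Δ'} → σ ≗ᴱ σ' → (A : Type Δ) → subTy σ A ≡ subTy σ' A
  subTy-≗ᴱ eq (atom P as) = cong (atom P) (subTms-≗ᴱ eq as)
  subTy-≗ᴱ eq (A ⇒ B)     = cong₂ _⇒_ (subTy-≗ᴱ eq A) (subTy-≗ᴱ eq B)
  subTy-≗ᴱ eq (all s A)   = cong (all s) (subTy-≗ᴱ (ext-≗ᴱ eq) A)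

  subSc-≗ᴱ : ∀ {Δ Δ'} {σ σ' : Env Δ Δ'} → σ ≗ᴱ σ' → (t : Scheme Δ) → subSc σ t ≡ subSc σ' t
  subSc-≗ᴱ eq (var A)    = cong var (subTy-≗ᴱ eq A)
  subSc-≗ᴱ eq (lam A t)  = cong₂ lam (subTy-≗ᴱ eq A) (subSc-≗ᴱ eq t)
  subSc-≗ᴱ eq (app t u)  = cong₂ app (subSc-≗ᴱ eq t) (subSc-≗ᴱ eq u)
  subSc-≗ᴱ eq (Lam s t)  = cong (Lam s) (subSc-≗ᴱ (ext-≗ᴱ eq) t)
  subSc-≗ᴱ eq (tapp t a) = cong₂ tapp (subSc-≗ᴱ eq t) (subTm-≗ᴱ eq a)

  nsubEnv : ∀ {Δ Δ'} → NameSubst → Env Δ Δ' → Env Δ Δ'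
  nsubEnv θ σ i = nsubTm θ (σ i)

  nsubEnv-ext : ∀ θ {Δ Δ' r} (σ : Env Δ Δ') → nsubEnv θ (ext {r = r} σ) ≗ᴱ ext (nsubEnv θ σ)
  nsubEnv-ext θ σ (here p)  = refl
  nsubEnv-ext θ σ (there i) = nsubTm-renTm θ there (σ i)

  nsubEnv-inst₀ : ∀ θ {Δ s} (a : Term Δ s) → nsubEnv θ (inst₀ a) ≗ᴱ inst₀ (nsubTm θ a)
  nsubEnv-inst₀ θ a (here refl) = refl
  nsubEnv-inst₀ θ a (there i)   = refl

  mutual
    nsubTm-subTm : ∀ θ {Δ Δ' s} (σ : Env Δ Δ') (a : Term Δ s) →
                   nsubTm θ (subTm σ a) ≡ subTm (nsubEnv θ σ) (nsubTm θ a)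
    nsubTm-subTm θ σ (bv i)     = refl
    nsubTm-subTm θ σ (fv x)     = sym (subTm-closed _ _ _ (θ x))
    nsubTm-subTm θ σ (fun f as) = cong (fun f) (nsubTms-subTms θ σ as)

    nsubTms-subTms : ∀ θ {Δ Δ' ss} (σ : Env Δ Δ') (as : Terms Δ ss) →
                     nsubTms θ (subTms σ as) ≡ subTms (nsubEnv θ σ) (nsubTms θ as)
    nsubTms-subTms θ σ []       = refl
    nsubTms-subTms θ σ (a ∷ as) = cong₂ _∷_ (nsubTm-subTm θ σ a) (nsubTms-subTms θ σ as)

  nsubTy-subTy : ∀ θ {Δ Δ'} (σ : Env Δ Δ') (A : Type Δ) →
                 nsubTy θ (subTy σ A) ≡ subTy (nsubEnv θ σ) (nsubTy θ A)
  nsubTy-subTy θ σ (atom P as) = cong (atom P) (nsubTms-subTms θ σ as)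
  nsubTy-subTy θ σ (A ⇒ B)     = cong₂ _⇒_ (nsubTy-subTy θ σ A) (nsubTy-subTy θ σ B)
  nsubTy-subTy θ σ (all s A)   =
    cong (all s) (trans (nsubTy-subTy θ (ext σ) A) (subTy-≗ᴱ (nsubEnv-ext θ σ) (nsubTy θ A)))

  nsubSc-subSc : ∀ θ {Δ Δ'} (σ : Env Δ Δ') (t : Scheme Δ) →
                 nsubSc θ (subSc σ t) ≡ subSc (nsubEnv θ σ) (nsubSc θ t)
  nsubSc-subSc θ σ (var A)    = cong var (nsubTy-subTy θ σ A)
  nsubSc-subSc θ σ (lam A t)  = cong₂ lam (nsubTy-subTy θ σ A) (nsubSc-subSc θ σ t)
  nsubSc-subSc θ σ (app t u)  = cong₂ app (nsubSc-subSc θ σ t) (nsubSc-subSc θ σ u)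
  nsubSc-subSc θ σ (Lam s t)  =
    cong (Lam s) (trans (nsubSc-subSc θ (ext σ) t) (subSc-≗ᴱ (nsubEnv-ext θ σ) (nsubSc θ t)))
  nsubSc-subSc θ σ (tapp t a) = cong₂ tapp (nsubSc-subSc θ σ t) (nsubTm-subTm θ σ a)

  nsubTy-instTy : ∀ θ {Δ s} (a : Term Δ s) (B : Type (s ∷ Δ)) →
                  nsubTy θ (instTy a B) ≡ instTy (nsubTm θ a) (nsubTy θ B)
  nsubTy-instTy θ a B = trans (nsubTy-subTy θ (inst₀ a) B) (subTy-≗ᴱ (nsubEnv-inst₀ θ a) (nsubTy θ B))

  nsubSc-instSc : ∀ θ {Δ s} (a : Term Δ s) (b : Scheme (s ∷ Δ)) →
                  nsubSc θ (instSc a b) ≡ instSc (nsubTm θ a) (nsubSc θ b)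
  nsubSc-instSc θ a b = trans (nsubSc-subSc θ (inst₀ a) b) (subSc-≗ᴱ (nsubEnv-inst₀ θ a) (nsubSc θ b))

  mutual
    nsubTm-⊙ : ∀ θ θ' {Δ s} (a : Term Δ s) → nsubTm θ (nsubTm θ' a) ≡ nsubTm (θ ⊙ θ') a
    nsubTm-⊙ θ θ' (bv i)     = refl
    nsubTm-⊙ θ θ' (fv x)     = nsubTm-renTm θ _ (θ' x)
    nsubTm-⊙ θ θ' (fun f as) = cong (fun f) (nsubTms-⊙ θ θ' as)

    nsubTms-⊙ : ∀ θ θ' {Δ ss} (as : Terms Δ ss) → nsubTms θ (nsubTms θ' as) ≡ nsubTms (θ ⊙ θ') as
    nsubTms-⊙ θ θ' []       = refl
    nsubTms-⊙ θ θ' (a ∷ as) = cong₂ _∷_ (nsubTm-⊙ θ θ' a) (nsubTms-⊙ θ θ' as)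

  nsubTy-⊙ : ∀ θ θ' {Δ} (A : Type Δ) → nsubTy θ (nsubTy θ' A) ≡ nsubTy (θ ⊙ θ') A
  nsubTy-⊙ θ θ' (atom P as) = cong (atom P) (nsubTms-⊙ θ θ' as)
  nsubTy-⊙ θ θ' (A ⇒ B)     = cong₂ _⇒_ (nsubTy-⊙ θ θ' A) (nsubTy-⊙ θ θ' B)
  nsubTy-⊙ θ θ' (all s A)   = cong (all s) (nsubTy-⊙ θ θ' A)

  nsubSc-⊙ : ∀ θ θ' {Δ} (t : Scheme Δ) → nsubSc θ (nsubSc θ' t) ≡ nsubSc (θ ⊙ θ') t
  nsubSc-⊙ θ θ' (var A)    = cong var (nsubTy-⊙ θ θ' A)
  nsubSc-⊙ θ θ' (lam A t)  = cong₂ lam (nsubTy-⊙ θ θ' A) (nsubSc-⊙ θ θ' t)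
  nsubSc-⊙ θ θ' (app t u)  = cong₂ app (nsubSc-⊙ θ θ' t) (nsubSc-⊙ θ θ' u)
  nsubSc-⊙ θ θ' (Lam s t)  = cong (Lam s) (nsubSc-⊙ θ θ' t)
  nsubSc-⊙ θ θ' (tapp t a) = cong₂ tapp (nsubSc-⊙ θ θ' t) (nsubTm-⊙ θ θ' a)

  mutual
    nsubTm-id : ∀ {Δ s} (a : Term Δ s) → nsubTm idₙ a ≡ a
    nsubTm-id (bv i)     = refl
    nsubTm-id (fv x)     = refl
    nsubTm-id (fun f as) = cong (fun f) (nsubTms-id as)

    nsubTms-id : ∀ {Δ ss} (as : Terms Δ ss) → nsubTms idₙ as ≡ as
    nsubTms-id []       = refl
    nsubTms-id (a ∷ as) = cong₂ _∷_ (nsubTm-id a) (nsubTms-id as)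

  nsubTy-id : ∀ {Δ} (A : Type Δ) → nsubTy idₙ A ≡ A
  nsubTy-id (atom P as) = cong (atom P) (nsubTms-id as)
  nsubTy-id (A ⇒ B)     = cong₂ _⇒_ (nsubTy-id A) (nsubTy-id B)
  nsubTy-id (all s A)   = cong (all s) (nsubTy-id A)

  nsubSc-id : ∀ {Δ} (t : Scheme Δ) → nsubSc idₙ t ≡ t
  nsubSc-id (var A)    = cong var (nsubTy-id A)
  nsubSc-id (lam A t)  = cong₂ lam (nsubTy-id A) (nsubSc-id t)
  nsubSc-id (app t u)  = cong₂ app (nsubSc-id t) (nsubSc-id u)
  nsubSc-id (Lam s t)  = cong (Lam s) (nsubSc-id t)
  nsubSc-id (tapp t a) = cong₂ tapp (nsubSc-id t) (nsubTm-id a)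

  _≗_on_ : NameSubst → NameSubst → (ℕ → Set) → Set
  θ ≗ θ' on P = ∀ v → P v → θ v ≡ θ' v

  mutual
    nsubTm-local : ∀ {θ θ' Δ s} (a : Term Δ s) → θ ≗ θ' on (λ v → OccTm v a) → nsubTm θ a ≡ nsubTm θ' a
    nsubTm-local (bv i)     eq = refl
    nsubTm-local (fv x)     eq = cong close (eq x fv-here)
    nsubTm-local (fun f as) eq = cong (fun f) (nsubTms-local as (λ v → eq v ∘ fun-arg))

    nsubTms-local : ∀ {θ θ' Δ ss} (as : Terms Δ ss) → θ ≗ θ' on (λ v → OccTms v as) →
                    nsubTms θ as ≡ nsubTms θ' as
    nsubTms-local []       eq = refl
    nsubTms-local (a ∷ as) eq =
      cong₂ _∷_ (nsubTm-local a (λ v → eq v ∘ head)) (nsubTms-local as (λ v → eq v ∘ tail))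

  nsubTy-local : ∀ {θ θ' Δ} (A : Type Δ) → θ ≗ θ' on (λ v → OccTy v A) → nsubTy θ A ≡ nsubTy θ' A
  nsubTy-local (atom P as) eq = cong (atom P) (nsubTms-local as (λ v → eq v ∘ atom-arg))
  nsubTy-local (A ⇒ B)     eq =
    cong₂ _⇒_ (nsubTy-local A (λ v → eq v ∘ imp-l)) (nsubTy-local B (λ v → eq v ∘ imp-r))
  nsubTy-local (all s A)   eq = cong (all s) (nsubTy-local A (λ v → eq v ∘ all-body))

  nsubSc-local : ∀ {θ θ' Δ} (t : Scheme Δ) → θ ≗ θ' on (λ v → OccSc v t) → nsubSc θ t ≡ nsubSc θ' t
  nsubSc-local (var A)    eq = cong var (nsubTy-local A (λ v → eq v ∘ var-ty))
  nsubSc-local (lam A t)  eq =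
    cong₂ lam (nsubTy-local A (λ v → eq v ∘ lam-ty)) (nsubSc-local t (λ v → eq v ∘ lam-body))
  nsubSc-local (app t u)  eq =
    cong₂ app (nsubSc-local t (λ v → eq v ∘ app-l)) (nsubSc-local u (λ v → eq v ∘ app-r))
  nsubSc-local (Lam s t)  eq = cong (Lam s) (nsubSc-local t (λ v → eq v ∘ Lam-body))
  nsubSc-local (tapp t a) eq =
    cong₂ tapp (nsubSc-local t (λ v → eq v ∘ tapp-l)) (nsubTm-local a (λ v → eq v ∘ tapp-r))

  nsubTy-fixed : ∀ {θ Δ} (A : Type Δ) → θ ≗ idₙ on (λ v → OccTy v A) → nsubTy θ A ≡ A
  nsubTy-fixed A eq = trans (nsubTy-local A eq) (nsubTy-id A)

  nsubSc-fixed : ∀ {θ Δ} (t : Scheme Δ) → θ ≗ idₙ on (λ v → OccSc v t) → nsubSc θ t ≡ t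
  nsubSc-fixed t eq = trans (nsubSc-local t eq) (nsubSc-id t)

  nsubCtx-fixed : ∀ {θ} (Γ : Context) → θ ≗ idₙ on (λ v → FreeIn v Γ) → nsubCtx θ Γ ≡ Γ
  nsubCtx-fixed []      eq = refl
  nsubCtx-fixed (A ∷ Γ) eq =
    cong₂ _∷_ (nsubTy-fixed A (λ v → eq v ∘ here)) (nsubCtx-fixed Γ (λ v → eq v ∘ there))

  mutual
    occ-renTm : ∀ {Δ Δ' s w} (ρ : Ren Δ Δ') (a : Term Δ s) → OccTm w (renTm ρ a) → OccTm w a
    occ-renTm ρ (fv x)     fv-here     = fv-here
    occ-renTm ρ (fun f as) (fun-arg o) = fun-arg (occ-renTms ρ as o)

    occ-renTms : ∀ {Δ Δ' ss w} (ρ : Ren Δ Δ') (as : Terms Δ ss) → OccTms w (renTms ρ as) → OccTms w as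
    occ-renTms ρ (a ∷ as) (head o) = head (occ-renTm ρ a o)
    occ-renTms ρ (a ∷ as) (tail o) = tail (occ-renTms ρ as o)

  OccursVia : NameSubst → ℕ → (ℕ → Set) → Set
  OccursVia θ w P = Σ ℕ λ v → P v × OccTm w (θ v)

  via : ∀ {θ w} {P Q : ℕ → Set} → (∀ {v} → P v → Q v) → OccursVia θ w P → OccursVia θ w Q
  via f (v , p , o) = v , f p , o

  mutual
    occ-nsubTm : ∀ {θ Δ s w} (a : Term Δ s) → OccTm w (nsubTm θ a) → OccursVia θ w (λ v → OccTm v a)
    occ-nsubTm {θ} (fv x) o           = x , fv-here , occ-renTm _ (θ x) o
    occ-nsubTm (fun f as) (fun-arg o) = via fun-arg (occ-nsubTms as o)

    occ-nsubTms : ∀ {θ Δ ss w} (as : Terms Δ ss) → OccTms w (nsubTms θ as) →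
                  OccursVia θ w (λ v → OccTms v as)
    occ-nsubTms (a ∷ as) (head o) = via head (occ-nsubTm a o)
    occ-nsubTms (a ∷ as) (tail o) = via tail (occ-nsubTms as o)

  occ-nsubTy : ∀ {θ Δ w} (A : Type Δ) → OccTy w (nsubTy θ A) → OccursVia θ w (λ v → OccTy v A)
  occ-nsubTy (atom P as) (atom-arg o) = via atom-arg (occ-nsubTms as o)
  occ-nsubTy (A ⇒ B)     (imp-l o)    = via imp-l (occ-nsubTy A o)
  occ-nsubTy (A ⇒ B)     (imp-r o)    = via imp-r (occ-nsubTy B o)
  occ-nsubTy (all s A)   (all-body o) = via all-body (occ-nsubTy A o)

  occ-nsubSc : ∀ {θ Δ w} (t : Scheme Δ) → OccSc w (nsubSc θ t) → OccursVia θ w (λ v → OccSc v t)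
  occ-nsubSc (var A)    (var-ty o)   = via var-ty (occ-nsubTy A o)
  occ-nsubSc (lam A t)  (lam-ty o)   = via lam-ty (occ-nsubTy A o)
  occ-nsubSc (lam A t)  (lam-body o) = via lam-body (occ-nsubSc t o)
  occ-nsubSc (app t u)  (app-l o)    = via app-l (occ-nsubSc t o)
  occ-nsubSc (app t u)  (app-r o)    = via app-r (occ-nsubSc u o)
  occ-nsubSc (Lam s t)  (Lam-body o) = via Lam-body (occ-nsubSc t o)
  occ-nsubSc (tapp t a) (tapp-l o)   = via tapp-l (occ-nsubSc t o)
  occ-nsubSc (tapp t a) (tapp-r o)   = via tapp-r (occ-nsubTm a o)

  occ-nsubCtx : ∀ {θ w} (Γ : Context) → FreeIn w (nsubCtx θ Γ) → OccursVia θ w (λ v → FreeIn v Γ)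
  occ-nsubCtx (A ∷ Γ) (here o)  = via here (occ-nsubTy A o)
  occ-nsubCtx (A ∷ Γ) (there o) = via there (occ-nsubCtx Γ o)

  mutual
    maxTm : ∀ {Δ s} → Term Δ s → ℕ
    maxTm (bv i)     = 0
    maxTm (fv x)     = x
    maxTm (fun f as) = maxTms as

    maxTms : ∀ {Δ ss} → Terms Δ ss → ℕ
    maxTms []       = 0
    maxTms (a ∷ as) = maxTm a ⊔ maxTms as

  maxTy : ∀ {Δ} → Type Δ → ℕ
  maxTy (atom P as) = maxTms as
  maxTy (A ⇒ B)     = maxTy A ⊔ maxTy B
  maxTy (all s A)   = maxTy A

  maxSc : ∀ {Δ} → Scheme Δ → ℕ
  maxSc (var A)    = maxTy A
  maxSc (lam A t)  = maxTy A ⊔ maxSc t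
  maxSc (app t u)  = maxSc t ⊔ maxSc u
  maxSc (Lam s t)  = maxSc t
  maxSc (tapp t a) = maxSc t ⊔ maxTm a

  maxCtx : Context → ℕ
  maxCtx []      = 0
  maxCtx (A ∷ Γ) = maxTy A ⊔ maxCtx Γ

  mutual
    occ⇒≤maxTm : ∀ {Δ s w} (a : Term Δ s) → OccTm w a → w ≤ maxTm a
    occ⇒≤maxTm (fv x)     fv-here     = ≤-refl
    occ⇒≤maxTm (fun f as) (fun-arg o) = occ⇒≤maxTms as o

    occ⇒≤maxTms : ∀ {Δ ss w} (as : Terms Δ ss) → OccTms w as → w ≤ maxTms as
    occ⇒≤maxTms (a ∷ as) (head o) = m≤n⇒m≤n⊔o (maxTms as) (occ⇒≤maxTm a o)
    occ⇒≤maxTms (a ∷ as) (tail o) = m≤n⇒m≤o⊔n (maxTm a) (occ⇒≤maxTms as o)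

  occ⇒≤maxTy : ∀ {Δ w} (A : Type Δ) → OccTy w A → w ≤ maxTy A
  occ⇒≤maxTy (atom P as) (atom-arg o) = occ⇒≤maxTms as o
  occ⇒≤maxTy (A ⇒ B)     (imp-l o)    = m≤n⇒m≤n⊔o (maxTy B) (occ⇒≤maxTy A o)
  occ⇒≤maxTy (A ⇒ B)     (imp-r o)    = m≤n⇒m≤o⊔n (maxTy A) (occ⇒≤maxTy B o)
  occ⇒≤maxTy (all s A)   (all-body o) = occ⇒≤maxTy A o

  occ⇒≤maxSc : ∀ {Δ w} (t : Scheme Δ) → OccSc w t → w ≤ maxSc t
  occ⇒≤maxSc (var A)    (var-ty o)   = occ⇒≤maxTy A o
  occ⇒≤maxSc (lam A t)  (lam-ty o)   = m≤n⇒m≤n⊔o (maxSc t) (occ⇒≤maxTy A o)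
  occ⇒≤maxSc (lam A t)  (lam-body o) = m≤n⇒m≤o⊔n (maxTy A) (occ⇒≤maxSc t o)
  occ⇒≤maxSc (app t u)  (app-l o)    = m≤n⇒m≤n⊔o (maxSc u) (occ⇒≤maxSc t o)
  occ⇒≤maxSc (app t u)  (app-r o)    = m≤n⇒m≤o⊔n (maxSc t) (occ⇒≤maxSc u o)
  occ⇒≤maxSc (Lam s t)  (Lam-body o) = occ⇒≤maxSc t o
  occ⇒≤maxSc (tapp t a) (tapp-l o)   = m≤n⇒m≤n⊔o (maxTm a) (occ⇒≤maxSc t o)
  occ⇒≤maxSc (tapp t a) (tapp-r o)   = m≤n⇒m≤o⊔n (maxSc t) (occ⇒≤maxTm a o)

  occ⇒≤maxCtx : ∀ {w} (Γ : Context) → FreeIn w Γ → w ≤ maxCtx Γ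
  occ⇒≤maxCtx (A ∷ Γ) (here o)  = m≤n⇒m≤n⊔o (maxCtx Γ) (occ⇒≤maxTy A o)
  occ⇒≤maxCtx (A ∷ Γ) (there o) = m≤n⇒m≤o⊔n (maxTy A) (occ⇒≤maxCtx Γ o)

  >maxTy⇒¬occ : ∀ {Δ z} (A : Type Δ) → maxTy A < z → ¬ OccTy z A
  >maxTy⇒¬occ A lt o = <⇒≱ lt (occ⇒≤maxTy A o)

  >maxSc⇒¬occ : ∀ {Δ z} (t : Scheme Δ) → maxSc t < z → ¬ OccSc z t
  >maxSc⇒¬occ t lt o = <⇒≱ lt (occ⇒≤maxSc t o)

  >maxCtx⇒¬free : ∀ {z} (Γ : Context) → maxCtx Γ < z → ¬ FreeIn z Γ
  >maxCtx⇒¬free Γ lt o = <⇒≱ lt (occ⇒≤maxCtx Γ o)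

  record FreshName (s : Sort) (ns : List ℕ) : Set where
    constructor fresh
    field
      name  : ℕ
      sort  : sortOf name ≡ s
      above : All (_< name) ns

  freshName : ∀ s ns → FreshName s ns
  freshName s ns with infVars s (max 0 ns)
  ... | z , max<z , e = fresh z e (All.map (λ n≤max → ≤-<-trans n≤max max<z) (xs≤max 0 ns))

  _↦_ : (x : ℕ) → Term [] (sortOf x) → NameSubst
  (x ↦ a) v = fsubTm x a (fv v)

  ↦-hit : ∀ x a → (x ↦ a) x ≡ a
  ↦-hit x a with x ≟ x
  ... | yes refl = renTm-closed-id _ a
  ... | no x≢x   = ⊥-elim (x≢x refl)

  ↦-miss : ∀ x a {v} → x ≢ v → (x ↦ a) v ≡ fv v
  ↦-miss x a {v} x≢v with x ≟ v
  ... | yes x≡v = ⊥-elim (x≢v x≡v)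
  ... | no _    = refl

  mutual
    fsubTm-nsub : ∀ {Δ s} x a (b : Term Δ s) → fsubTm x a b ≡ nsubTm (x ↦ a) b
    fsubTm-nsub x a (bv i) = refl
    fsubTm-nsub x a (fv y) with x ≟ y
    ... | yes refl = sym (renTm-closed _ _ _ a)
    ... | no _     = refl
    fsubTm-nsub x a (fun f bs) = cong (fun f) (fsubTms-nsub x a bs)

    fsubTms-nsub : ∀ {Δ ss} x a (bs : Terms Δ ss) → fsubTms x a bs ≡ nsubTms (x ↦ a) bs
    fsubTms-nsub x a []       = refl
    fsubTms-nsub x a (b ∷ bs) = cong₂ _∷_ (fsubTm-nsub x a b) (fsubTms-nsub x a bs)

  fsubTy-nsub : ∀ {Δ} x a (A : Type Δ) → fsubTy x a A ≡ nsubTy (x ↦ a) A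
  fsubTy-nsub x a (atom P as) = cong (atom P) (fsubTms-nsub x a as)
  fsubTy-nsub x a (A ⇒ B)     = cong₂ _⇒_ (fsubTy-nsub x a A) (fsubTy-nsub x a B)
  fsubTy-nsub x a (all s A)   = cong (all s) (fsubTy-nsub x a A)

  ↦-fresh : ∀ x a (P : ℕ → Set) → ¬ P x → (x ↦ a) ≗ idₙ on P
  ↦-fresh x a P ¬Px v Pv = ↦-miss x a (λ x≡v → ¬Px (subst P (sym x≡v) Pv))

  -- infVars only provides names whose sort is propositionally the one required.

  nameAt : ∀ {Δ s} (x : ℕ) → sortOf x ≡ s → Term Δ s
  nameAt x refl = fv x

  nameAt-cong : ∀ {Δ s x y} → x ≡ y → (e : sortOf x ≡ s) (e' : sortOf y ≡ s) →
                nameAt {Δ} x e ≡ nameAt y e'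
  nameAt-cong refl refl refl = refl

  renTm-nameAt : ∀ {Δ Δ' s x} (ρ : Ren Δ Δ') (e : sortOf x ≡ s) → renTm ρ (nameAt x e) ≡ nameAt x e
  renTm-nameAt ρ refl = refl

  nsubTm-nameAt : ∀ {θ Δ s x} (e : sortOf x ≡ s) → θ x ≡ fv x → nsubTm {Δ} θ (nameAt x e) ≡ nameAt x e
  nsubTm-nameAt refl θx≡x = cong close θx≡x

  occ-nameAt : ∀ {Δ s x w} (e : sortOf x ≡ s) → OccTm w (nameAt {Δ} x e) → w ≡ x
  occ-nameAt refl fv-here = refl

  ⊙↦-fresh-Ty : ∀ θ x a {Δ} (A : Type Δ) → ¬ OccTy x A → nsubTy (θ ⊙ (x ↦ a)) A ≡ nsubTy θ A
  ⊙↦-fresh-Ty θ x a A ¬x =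
    trans (sym (nsubTy-⊙ θ (x ↦ a) A)) (cong (nsubTy θ) (nsubTy-fixed A (↦-fresh x a _ ¬x)))

  ⊙↦-fresh-Sc : ∀ θ x a {Δ} (t : Scheme Δ) → ¬ OccSc x t → nsubSc (θ ⊙ (x ↦ a)) t ≡ nsubSc θ t
  ⊙↦-fresh-Sc θ x a t ¬x =
    trans (sym (nsubSc-⊙ θ (x ↦ a) t)) (cong (nsubSc θ) (nsubSc-fixed t (↦-fresh x a _ ¬x)))

  ⊙↦-fresh-ctx : ∀ θ x a {Γ} (P : Prop → Set) → (∀ {C} → C ∈ Γ → P (nsubTy θ C)) → ¬ FreeIn x Γ →
                 ∀ {C} → C ∈ Γ → P (nsubTy (θ ⊙ (x ↦ a)) C)
  ⊙↦-fresh-ctx θ x a P h ¬x {C} C∈Γ = subst P (sym (⊙↦-fresh-Ty θ x a C (¬x ∘ lose C∈Γ))) (h C∈Γ)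

  ⊙↦-nameAt : ∀ θ x z (e : sortOf z ≡ sortOf x) → θ z ≡ fv z →
              nsubTm {[]} (θ ⊙ (x ↦ nameAt z e)) (fv x) ≡ nameAt z e
  ⊙↦-nameAt θ x z e θz≡z =
    trans (cong (close ∘ nsubTm θ) (↦-hit x (nameAt z e)))
          (trans (cong close (nsubTm-nameAt e θz≡z)) (renTm-nameAt _ e))

  rebind-openSc : ∀ θ x z (e : sortOf z ≡ sortOf x) (b : Scheme (sortOf x ∷ [])) →
                  θ z ≡ fv z → ¬ OccSc x b →
                  nsubSc (θ ⊙ (x ↦ nameAt z e)) (openSc x b) ≡ instSc (nameAt z e) (nsubSc θ b)
  rebind-openSc θ x z e b θz≡z ¬x =
    trans (nsubSc-instSc _ (fv x) b) (cong₂ instSc (⊙↦-nameAt θ x z e θz≡z) (⊙↦-fresh-Sc θ x _ b ¬x))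

  rebind-openTy : ∀ θ x z (e : sortOf z ≡ sortOf x) (B : Type (sortOf x ∷ [])) →
                  θ z ≡ fv z → ¬ OccTy x B →
                  nsubTy (θ ⊙ (x ↦ nameAt z e)) (openTy x B) ≡ instTy (nameAt z e) (nsubTy θ B)
  rebind-openTy θ x z e B θz≡z ¬x =
    trans (nsubTy-instTy _ (fv x) B) (cong₂ instTy (⊙↦-nameAt θ x z e θz≡z) (⊙↦-fresh-Ty θ x _ B ¬x))

  ↦-value : ∀ z a → nsubTm {[]} (z ↦ a) (fv z) ≡ a
  ↦-value z a = trans (cong close (↦-hit z a)) (renTm-closed-id _ a)

  ↦-openSc : ∀ z a (c : Scheme (sortOf z ∷ [])) → ¬ OccSc z c → nsubSc (z ↦ a) (openSc z c) ≡ instSc a c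
  ↦-openSc z a c ¬z =
    trans (nsubSc-instSc _ (fv z) c) (cong₂ instSc (↦-value z a) (nsubSc-fixed c (↦-fresh z a _ ¬z)))

  ↦-openTy : ∀ z a (C : Type (sortOf z ∷ [])) → ¬ OccTy z C → nsubTy (z ↦ a) (openTy z C) ≡ instTy a C
  ↦-openTy z a C ¬z =
    trans (nsubTy-instTy _ (fv z) C) (cong₂ instTy (↦-value z a) (nsubTy-fixed C (↦-fresh z a _ ¬z)))

  SubstIn-Lam-at : ∀ {σ Δ s} (y : ℕ) (e : sortOf y ≡ s) {c c' : Scheme (s ∷ [])} →
                   ¬ OccSc y (Lam s c) → ¬ OccSubst y σ → ¬ OccSc y (Lam s c') →
                   SubstIn σ Δ (instSc (nameAt y e) c) (instSc (nameAt y e) c') → SubstIn σ Δ (Lam s c) (Lam s c')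
  SubstIn-Lam-at y refl = Lam y

  ▷-LamC-at : ∀ {Δ s} (y : ℕ) (e : sortOf y ≡ s) {c c' : Scheme (s ∷ [])} →
              ¬ FreeIn y Δ → ¬ OccSc y (Lam s c) → ¬ OccSc y (Lam s c') →
              Δ ⊢ instSc (nameAt y e) c ▷ instSc (nameAt y e) c' → Δ ⊢ Lam s c ▷ Lam s c'
  ▷-LamC-at y refl = LamC y

  data Lam-SubstIn (σ : SchSubst) (Δ : Context) {s : Sort} (c : Scheme (s ∷ [])) : Sch → Set where
    binder : ∀ (y : ℕ) (e : sortOf y ≡ s) {c' : Scheme (s ∷ [])} →
             ¬ OccSc y (Lam s c) → ¬ OccSubst y σ → ¬ OccSc y (Lam s c') →
             SubstIn σ Δ (instSc (nameAt y e) c) (instSc (nameAt y e) c') → Lam-SubstIn σ Δ c (Lam s c')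

  Lam-SubstIn⁻¹ : ∀ {σ Δ s} {c : Scheme (s ∷ [])} {v} → SubstIn σ Δ (Lam s c) v → Lam-SubstIn σ Δ c v
  Lam-SubstIn⁻¹ (Lam y ¬c ¬σ ¬c' r) = binder y refl ¬c ¬σ ¬c' r

  data Lam▷ (Δ : Context) {s : Sort} (c : Scheme (s ∷ [])) : Sch → Set where
    binder : ∀ (y : ℕ) (e : sortOf y ≡ s) {c' : Scheme (s ∷ [])} →
             ¬ FreeIn y Δ → ¬ OccSc y (Lam s c) → ¬ OccSc y (Lam s c') →
             Δ ⊢ instSc (nameAt y e) c ▷ instSc (nameAt y e) c' → Lam▷ Δ c (Lam s c')

  Lam▷⁻¹ : ∀ {Δ s} {c : Scheme (s ∷ [])} {v} → Δ ⊢ Lam s c ▷ v → Lam▷ Δ c v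
  Lam▷⁻¹ (top ())
  Lam▷⁻¹ (LamC y ¬Δ ¬c ¬c' r) = binder y refl ¬Δ ¬c ¬c' r

  SubstIn-ctx : ∀ {σ Δ Δ' t v} → (∀ {C t'} → (C , t') ∈ σ → C ∈ Δ → C ∈ Δ') →
                SubstIn σ Δ t v → SubstIn σ Δ' t v
  SubstIn-ctx h (var-keep m C∈Δ)    = var-keep m (h m C∈Δ)
  SubstIn-ctx h (var-repl m)        = var-repl m
  SubstIn-ctx h (var-nodom ∉σ)      = var-nodom ∉σ
  SubstIn-ctx h (lam r)             =
    lam (SubstIn-ctx (λ { m (here refl) → here refl ; m (there C∈Δ) → there (h m C∈Δ) }) r)
  SubstIn-ctx h (app r r')          = app (SubstIn-ctx h r) (SubstIn-ctx h r')
  SubstIn-ctx h (Lam y ¬c ¬σ ¬c' r) = Lam y ¬c ¬σ ¬c' (SubstIn-ctx h r)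
  SubstIn-ctx h (tapp r)            = tapp (SubstIn-ctx h r)

  swapℕ : ℕ → ℕ → ℕ → ℕ
  swapℕ y z v with v ≟ y | v ≟ z
  ... | yes _ | _     = z
  ... | no _  | yes _ = y
  ... | no _  | no _  = v

  swapℕ-sort : ∀ {y z} → sortOf y ≡ sortOf z → ∀ v → sortOf (swapℕ y z v) ≡ sortOf v
  swapℕ-sort {y} {z} p v with v ≟ y | v ≟ z
  ... | yes refl | _        = sym p
  ... | no _     | yes refl = p
  ... | no _     | no _     = refl

  swapℕ-left : ∀ y z → swapℕ y z y ≡ z
  swapℕ-left y z with y ≟ y | y ≟ z
  ... | yes _  | _ = refl
  ... | no y≢y | _ = ⊥-elim (y≢y refl)

  swapℕ-right : ∀ y z → swapℕ y z z ≡ y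
  swapℕ-right y z with z ≟ y | z ≟ z
  ... | yes z≡y | _      = z≡y
  ... | no _    | yes _  = refl
  ... | no _    | no z≢z = ⊥-elim (z≢z refl)

  swapℕ-other : ∀ y z {v} → v ≢ y → v ≢ z → swapℕ y z v ≡ v
  swapℕ-other y z {v} v≢y v≢z with v ≟ y | v ≟ z
  ... | yes v≡y | _       = ⊥-elim (v≢y v≡y)
  ... | no _    | yes v≡z = ⊥-elim (v≢z v≡z)
  ... | no _    | no _    = refl

  swapℕ-involutive : ∀ y z v → swapℕ y z (swapℕ y z v) ≡ v
  swapℕ-involutive y z v with v ≟ y | v ≟ z
  ... | yes refl | _        = swapℕ-right v z
  ... | no _     | yes refl = swapℕ-left y v
  ... | no v≢y   | no v≢z   = swapℕ-other y z v≢y v≢z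

  swap : (y z : ℕ) → sortOf y ≡ sortOf z → NameSubst
  swap y z p v = nameAt (swapℕ y z v) (swapℕ-sort p v)

  module Swap (y z : ℕ) (p : sortOf y ≡ sortOf z) where

    π : NameSubst
    π = swap y z p

    π-nameAt : ∀ {Δ s w} (e : sortOf w ≡ s) (e' : sortOf (swapℕ y z w) ≡ s) →
               nsubTm {Δ} π (nameAt w e) ≡ nameAt (swapℕ y z w) e'
    π-nameAt {w = w} refl e' = trans (renTm-nameAt _ (swapℕ-sort p w)) (nameAt-cong refl _ e')

    π-fixes : ∀ (P : ℕ → Set) → ¬ P y → ¬ P z → π ≗ idₙ on P
    π-fixes P ¬Py ¬Pz v Pv =
      nameAt-cong (swapℕ-other y z (λ v≡y → ¬Py (subst P v≡y Pv)) (λ v≡z → ¬Pz (subst P v≡z Pv))) _ refl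

    π-involutive : ∀ v → (π ⊙ π) v ≡ idₙ v
    π-involutive v =
      trans (π-nameAt (swapℕ-sort p v) (cong sortOf (swapℕ-involutive y z v)))
            (nameAt-cong (swapℕ-involutive y z v) _ refl)

    nsubTy-π-π : ∀ {Δ} (A : Type Δ) → nsubTy π (nsubTy π A) ≡ A
    nsubTy-π-π A = trans (nsubTy-⊙ π π A) (nsubTy-fixed A (λ v _ → π-involutive v))

    occ-π : ∀ {w} (P : ℕ → Set) → OccursVia π w P → P (swapℕ y z w)
    occ-π {w} P (v , Pv , o) =
      subst P (trans (sym (swapℕ-involutive y z v)) (cong (swapℕ y z) (sym (occ-nameAt (swapℕ-sort p v) o)))) Pv

    π-fresh : ∀ x (P : ℕ → Set) → ¬ P x → ¬ OccursVia π (swapℕ y z x) P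
    π-fresh x P ¬Px ov = ¬Px (subst P (swapℕ-involutive y z x) (occ-π P ov))

    π-openSc : ∀ x (b : Scheme (sortOf x ∷ [])) →
               nsubSc π (openSc x b) ≡ instSc (nameAt (swapℕ y z x) (swapℕ-sort p x)) (nsubSc π b)
    π-openSc x b =
      trans (nsubSc-instSc π (fv x) b) (cong (λ a → instSc a (nsubSc π b)) (renTm-nameAt _ (swapℕ-sort p x)))

    π-instSc : ∀ {s} (ey : sortOf y ≡ s) (ez : sortOf z ≡ s) (c : Scheme (s ∷ [])) →
               ¬ OccSc y c → ¬ OccSc z c → nsubSc π (instSc (nameAt y ey) c) ≡ instSc (nameAt z ez) c
    π-instSc ey ez c ¬y ¬z =
      trans (nsubSc-instSc π (nameAt y ey) c)
            (cong₂ instSc (trans (π-nameAt ey (trans (cong sortOf (swapℕ-left y z)) ez))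
                                 (nameAt-cong (swapℕ-left y z) _ ez))
                          (nsubSc-fixed c (π-fixes (λ v → OccSc v c) ¬y ¬z)))

    nsubTy-π-injective : ∀ {Δ} {A B : Type Δ} → nsubTy π A ≡ nsubTy π B → A ≡ B
    nsubTy-π-injective {A = A} {B} πA≡πB =
      trans (sym (nsubTy-π-π A)) (trans (cong (nsubTy π) πA≡πB) (nsubTy-π-π B))

    ¬occ-π-Lam : ∀ x {s} (c : Scheme (s ∷ [])) → ¬ OccSc x (Lam s c) →
                 ¬ OccSc (swapℕ y z x) (Lam s (nsubSc π c))
    ¬occ-π-Lam x c ¬x = π-fresh x _ ¬x ∘ occ-nsubSc (Lam _ c)

    nsubSubst : SchSubst → SchSubst
    nsubSubst = map (Prod.map (nsubTy π) (nsubSc π))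

    occSubst-π : ∀ {w} (σ : SchSubst) → OccSubst w (nsubSubst σ) → OccSubst (swapℕ y z w) σ
    occSubst-π ((A , t) ∷ σ) (here (inj₁ o)) = here (inj₁ (occ-π _ (occ-nsubTy A o)))
    occSubst-π ((A , t) ∷ σ) (here (inj₂ o)) = here (inj₂ (occ-π _ (occ-nsubSc t o)))
    occSubst-π (_ ∷ σ)       (there o)       = there (occSubst-π σ o)

    ∉dom-π : ∀ {A} (σ : SchSubst) → (∀ t → ¬ (A , t) ∈ σ) →
             ∀ t → ¬ (nsubTy π A , t) ∈ nsubSubst σ
    ∉dom-π σ A∉σ t m with ∈-map⁻ _ m
    ... | (A' , t') , m' , eq =
      A∉σ t' (subst (λ B → (B , t') ∈ σ) (sym (nsubTy-π-injective (cong proj₁ eq))) m')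

    SubstIn-π : ∀ {σ Δ t v} → SubstIn σ Δ t v →
                SubstIn (nsubSubst σ) (nsubCtx π Δ) (nsubSc π t) (nsubSc π v)
    SubstIn-π (var-keep m C∈Δ)   = var-keep (∈-map⁺ _ m) (∈-map⁺ _ C∈Δ)
    SubstIn-π (var-repl m)       = var-repl (∈-map⁺ _ m)
    SubstIn-π {σ} (var-nodom ∉σ) = var-nodom (∉dom-π σ ∉σ)
    SubstIn-π (lam r)            = lam (SubstIn-π r)
    SubstIn-π (app r r')         = app (SubstIn-π r) (SubstIn-π r')
    SubstIn-π {σ} (Lam x {b} {b'} ¬b ¬σ ¬b' r) =
      SubstIn-Lam-at (swapℕ y z x) (swapℕ-sort p x) (¬occ-π-Lam x b ¬b)
        (¬σ ∘ subst (λ w → OccSubst w σ) (swapℕ-involutive y z x) ∘ occSubst-π σ) (¬occ-π-Lam x b' ¬b')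
        (subst₂ (SubstIn _ _) (π-openSc x b) (π-openSc x b') (SubstIn-π r))
    SubstIn-π (tapp r)           = tapp (SubstIn-π r)

    ▷-π : ∀ {Δ t t'} → Δ ⊢ t ▷ t' → nsubCtx π Δ ⊢ nsubSc π t ▷ nsubSc π t'
    ▷-π (top (β⇒ r))                      = top (β⇒ (SubstIn-π r))
    ▷-π {Δ} (top (β∀ {s} {b} {a}))        =
      subst (nsubCtx π Δ ⊢ tapp (Lam s (nsubSc π b)) (nsubTm π a) ▷_) (sym (nsubSc-instSc π a b)) (top β∀)
    ▷-π (appL r)                          = appL (▷-π r)
    ▷-π (tappL r)                         = tappL (▷-π r)
    ▷-π {Δ} (LamC x {b} {b'} ¬Δ ¬b ¬b' r) =
      ▷-LamC-at (swapℕ y z x) (swapℕ-sort p x) (π-fresh x _ ¬Δ ∘ occ-nsubCtx Δ)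
        (¬occ-π-Lam x b ¬b) (¬occ-π-Lam x b' ¬b')
        (subst₂ (_ ⊢_▷_) (π-openSc x b) (π-openSc x b') (▷-π r))
    ▷-π (appR r)                          = appR (▷-π r)
    ▷-π (lamC r)                          = lamC (▷-π r)

    ▷-π-fixed : ∀ {Δ t t'} → ¬ FreeIn y Δ → ¬ FreeIn z Δ → Δ ⊢ t ▷ t' →
                Δ ⊢ nsubSc π t ▷ nsubSc π t'
    ▷-π-fixed {Δ} ¬y ¬z r = subst (_⊢ _ ▷ _) (nsubCtx-fixed Δ (π-fixes _ ¬y ¬z)) (▷-π r)

    SubstIn-π-fixed : ∀ {Δ A u t v} → ¬ OccTy y A → ¬ OccTy z A → ¬ OccSc y u → ¬ OccSc z u →
                      SubstIn [ (A , u) ] Δ t v → SubstIn [ (A , u) ] Δ (nsubSc π t) (nsubSc π v)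
    SubstIn-π-fixed {Δ} {A} {u} ¬yA ¬zA ¬yu ¬zu r =
      SubstIn-ctx back (subst₂ (λ B w → SubstIn [ (B , w) ] _ _ _) πA≡A πu≡u (SubstIn-π r))
      where
        πA≡A : nsubTy π A ≡ A
        πA≡A = nsubTy-fixed A (π-fixes _ ¬yA ¬zA)
        πu≡u : nsubSc π u ≡ u
        πu≡u = nsubSc-fixed u (π-fixes _ ¬yu ¬zu)
        back : ∀ {C t'} → (C , t') ∈ [ (A , u) ] → C ∈ nsubCtx π Δ → C ∈ Δ
        back (here refl) A∈πΔ with ∈-map⁻ _ A∈πΔ
        ... | D , D∈Δ , A≡πD = subst (_∈ Δ) (sym (nsubTy-π-injective (trans πA≡A A≡πD))) D∈Δ


module Typed (L : Language) (_≈_ : Lang.Prop L → Lang.Prop L → Set)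
             (cg : Lang.IsCongruence L _≈_) (nc : Lang.NonConfusing L _≈_) where
  open Lang L
  open Syntax L
  open Typing _≈_
  open IsCongruence cg
  open NonConfusing nc

  record Admissible (θ : NameSubst) : Set where
    field
      support : ℕ
      outside : ∀ v → support < v → θ v ≡ fv v
      pres-≈  : ∀ {A B} → A ≈ B → nsubTy θ A ≈ nsubTy θ B
  open Admissible

  admissible-id : Admissible idₙ
  admissible-id = record
    { support = 0
    ; outside = λ _ _ → refl
    ; pres-≈  = λ {A} {B} → subst₂ _≈_ (sym (nsubTy-id A)) (sym (nsubTy-id B))
    }

  admissible-↦ : ∀ x a → Admissible (x ↦ a)
  admissible-↦ x a = record
    { support = x
    ; outside = λ v x<v → ↦-miss x a (λ x≡v → <⇒≱ x<v (≤-reflexive (sym x≡v)))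
    ; pres-≈  = λ {A} {B} A≈B → subst₂ _≈_ (fsubTy-nsub x a A) (fsubTy-nsub x a B) (subst≈ x a A≈B)
    }

  admissible-⊙ : ∀ {θ θ'} → Admissible θ → Admissible θ' → Admissible (θ ⊙ θ')
  admissible-⊙ {θ} {θ'} g g' = record
    { support = support g ⊔ support g'
    ; outside = λ v lt → trans (cong (nsubTm θ) (outside g' v (≤-<-trans (m≤n⊔m _ _) lt)))
                               (cong close (outside g v (≤-<-trans (m≤m⊔n _ _) lt)))
    ; pres-≈  = λ {A} {B} A≈B →
                  subst₂ _≈_ (nsubTy-⊙ θ θ' A) (nsubTy-⊙ θ θ' B) (pres-≈ g (pres-≈ g' A≈B))
    }

  ∀i-at : ∀ {Γ s} (z : ℕ) (e : sortOf z ≡ s) {b : Scheme (s ∷ [])} {B : Type (s ∷ [])} →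
          ¬ FreeIn z Γ → ¬ OccSc z (Lam s b) → ¬ OccTy z (all s B) →
          Γ ⊢ instSc (nameAt z e) b ∶ instTy (nameAt z e) B → Γ ⊢ Lam s b ∶ all s B
  ∀i-at z refl = ∀i z

  ¬occ-Lam : ∀ {z s} {b : Scheme (s ∷ [])} → ¬ OccSc z b → ¬ OccSc z (Lam s b)
  ¬occ-Lam ¬b (Lam-body o) = ¬b o

  ¬occ-all : ∀ {z s} {B : Type (s ∷ [])} → ¬ OccTy z B → ¬ OccTy z (all s B)
  ¬occ-all ¬B (all-body o) = ¬B o

  ∷-mono : ∀ {f : Prop → Prop} {Γ Δ A} → (∀ {C} → C ∈ Γ → f C ∈ Δ) →
           ∀ {C} → C ∈ A ∷ Γ → f C ∈ f A ∷ Δ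
  ∷-mono h (here refl) = here refl
  ∷-mono h (there C∈Γ) = there (h C∈Γ)

  ⊢-nsub : ∀ {Γ t A} → Γ ⊢ t ∶ A → ∀ {θ Δ} → Admissible θ → (∀ {C} → C ∈ Γ → nsubTy θ C ∈ Δ) →
           Δ ⊢ nsubSc θ t ∶ nsubTy θ A
  ⊢-nsub (ax A∈Γ)   g h = ax (h A∈Γ)
  ⊢-nsub (⇒i d)     g h = ⇒i (⊢-nsub d g (∷-mono h))
  ⊢-nsub (⇒e d d')  g h = ⇒e (⊢-nsub d g h) (⊢-nsub d' g h)
  ⊢-nsub (∀e {B = B} d a) {θ} {Δ} g h =
    subst (Δ ⊢ _ ∶_) (sym (nsubTy-instTy θ a B)) (∀e (⊢-nsub d g h) (nsubTm θ a))
  ⊢-nsub (conv d A≈B) g h = conv (⊢-nsub d g h) (pres-≈ g A≈B)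
  ⊢-nsub (∀i x {b} {B} ¬Γ ¬b ¬B d) {θ} {Δ} g h = at (freshName (sortOf x) bounds)
    where
      bounds : List ℕ
      bounds = support g ∷ maxCtx Δ ∷ maxSc (nsubSc θ b) ∷ maxTy (nsubTy θ B) ∷ []
      at : FreshName (sortOf x) bounds → Δ ⊢ Lam (sortOf x) (nsubSc θ b) ∶ all (sortOf x) (nsubTy θ B)
      at (fresh z e (θ<z ∷ Δ<z ∷ b<z ∷ B<z ∷ [])) =
        ∀i-at z e (>maxCtx⇒¬free Δ Δ<z) (¬occ-Lam (>maxSc⇒¬occ _ b<z)) (¬occ-all (>maxTy⇒¬occ _ B<z))
          (subst₂ (Δ ⊢_∶_) (rebind-openSc θ x z e b θz (¬b ∘ Lam-body))
                           (rebind-openTy θ x z e B θz (¬B ∘ all-body))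
            (⊢-nsub d (admissible-⊙ g (admissible-↦ x (nameAt z e))) (⊙↦-fresh-ctx θ x _ (_∈ Δ) h ¬Γ)))
        where
          θz : θ z ≡ fv z
          θz = outside g z θ<z

  ⊢-weaken : ∀ {Γ Δ t A} → (∀ {C} → C ∈ Γ → C ∈ Δ) → Γ ⊢ t ∶ A → Δ ⊢ t ∶ A
  ⊢-weaken {Δ = Δ} {t} {A} Γ⊆Δ d =
    subst₂ (Δ ⊢_∶_) (nsubSc-id t) (nsubTy-id A)
      (⊢-nsub d admissible-id (λ {C} C∈Γ → subst (_∈ Δ) (sym (nsubTy-id C)) (Γ⊆Δ C∈Γ)))

  ⊢-instantiate : ∀ {Δ} x {c C} →
                  ¬ FreeIn x Δ → ¬ OccSc x (Lam (sortOf x) c) → ¬ OccTy x (all (sortOf x) C) →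
                  Δ ⊢ openSc x c ∶ openTy x C → (a : Term [] (sortOf x)) → Δ ⊢ instSc a c ∶ instTy a C
  ⊢-instantiate {Δ} x {c} {C} ¬Δ ¬c ¬C d a =
    subst₂ (Δ ⊢_∶_) (↦-openSc x a c (¬c ∘ Lam-body)) (↦-openTy x a C (¬C ∘ all-body))
      (⊢-nsub d (admissible-↦ x a)
        (λ {D} D∈Δ → subst (_∈ Δ) (sym (nsubTy-fixed D (↦-fresh x a _ (¬Δ ∘ lose D∈Δ)))) D∈Δ))

  all-inv-inst : ∀ {s C C'} → all s C ≈ all s C' → (a : Term [] s) → instTy a C ≈ instTy a C'
  all-inv-inst {s} {C} {C'} C≈C' = at (freshName s (maxTy C ∷ maxTy C' ∷ []))
    where
      at : FreshName s (maxTy C ∷ maxTy C' ∷ []) → (a : Term [] s) → instTy a C ≈ instTy a C'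
      at (fresh z refl (C<z ∷ C'<z ∷ [])) a =
        subst₂ _≈_ (inst C (>maxTy⇒¬occ C C<z)) (inst C' (>maxTy⇒¬occ C' C'<z))
          (subst≈ z a (all-inv z (¬occ-all (>maxTy⇒¬occ C C<z)) (¬occ-all (>maxTy⇒¬occ C' C'<z)) C≈C'))
        where
          inst : ∀ D → ¬ OccTy z D → fsubTy z a (openTy z D) ≡ instTy a D
          inst D ¬D = trans (fsubTy-nsub z a _) (↦-openTy z a D ¬D)

  ⊢lam⁻¹ : ∀ {Γ A t C} → Γ ⊢ lam A t ∶ C → Σ Prop λ B → (A ∷ Γ ⊢ t ∶ B) × (A ⇒ B) ≈ C
  ⊢lam⁻¹ (⇒i d) = _ , d , refl≈
  ⊢lam⁻¹ (conv d B≈C) with ⊢lam⁻¹ d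
  ... | B , d' , A⇒B≈B = B , d' , trans≈ A⇒B≈B B≈C

  data Lam-Typing (Γ : Context) : (s : Sort) → Scheme (s ∷ []) → Prop → Set where
    gen : ∀ (x : ℕ) {b B C} → ¬ FreeIn x Γ → ¬ OccSc x (Lam (sortOf x) b) →
          ¬ OccTy x (all (sortOf x) B) → Γ ⊢ openSc x b ∶ openTy x B →
          all (sortOf x) B ≈ C → Lam-Typing Γ (sortOf x) b C

  ⊢Lam⁻¹ : ∀ {Γ s b C} → Γ ⊢ Lam s b ∶ C → Lam-Typing Γ s b C
  ⊢Lam⁻¹ (∀i x ¬Γ ¬b ¬B d) = gen x ¬Γ ¬b ¬B d refl≈
  ⊢Lam⁻¹ (conv d B≈C) with ⊢Lam⁻¹ d
  ... | gen x ¬Γ ¬b ¬B d' A≈B = gen x ¬Γ ¬b ¬B d' (trans≈ A≈B B≈C)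

  ⊢Lam-inst : ∀ {Γ s c C} → Γ ⊢ Lam s c ∶ all s C → (a : Term [] s) → Γ ⊢ instSc a c ∶ instTy a C
  ⊢Lam-inst d a with ⊢Lam⁻¹ d
  ... | gen x ¬Γ ¬c ¬B d' B≈C = conv (⊢-instantiate x ¬Γ ¬c ¬B d' a) (all-inv-inst B≈C a)

  ⊢-substIn : ∀ {Γ t B} → Γ ⊢ t ∶ B → ∀ {θ Δ A u v} → Admissible θ →
              (∀ {C} → C ∈ Γ → nsubTy θ C ≡ A ⊎ nsubTy θ C ∈ Δ) → Δ ⊢ u ∶ A →
              SubstIn [ (A , u) ] Δ (nsubSc θ t) v → Δ ⊢ v ∶ nsubTy θ B
  ⊢-substIn (ax _) g h ⊢u (var-keep _ A∈Δ)        = ax A∈Δ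
  ⊢-substIn (ax _) g h ⊢u (var-repl (here refl))  = ⊢u
  ⊢-substIn (ax C∈Γ) {u = u} g h ⊢u (var-nodom ∉σ) with h C∈Γ
  ... | inj₁ θC≡A = ⊥-elim (∉σ u (here (cong (_, u) θC≡A)))
  ... | inj₂ θC∈Δ = ax θC∈Δ
  ⊢-substIn (⇒i d) {θ} {Δ} {A} g h ⊢u (lam r)     = ⇒i (⊢-substIn d g h' (⊢-weaken there ⊢u) r)
    where
      h' : ∀ {C} → C ∈ _ → nsubTy θ C ≡ A ⊎ nsubTy θ C ∈ _
      h' (here refl) = inj₂ (here refl)
      h' (there C∈Γ) = Sum.map₂ there (h C∈Γ)
  ⊢-substIn (⇒e d d') g h ⊢u (app r r')           = ⇒e (⊢-substIn d g h ⊢u r) (⊢-substIn d' g h ⊢u r')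
  ⊢-substIn (∀e {B = B} d a) {θ} {Δ} g h ⊢u (tapp r) =
    subst (Δ ⊢ _ ∶_) (sym (nsubTy-instTy θ a B)) (∀e (⊢-substIn d g h ⊢u r) (nsubTm θ a))
  ⊢-substIn (conv d B≈C) g h ⊢u r                 = conv (⊢-substIn d g h ⊢u r) (pres-≈ g B≈C)
  ⊢-substIn (∀i x {b} {B} ¬Γ ¬b ¬B d) {θ} {Δ} {A} {u} g h ⊢u r with Lam-SubstIn⁻¹ r
  ... | binder y ey {b'} ¬yb ¬yσ ¬yb' r' = at (freshName (sortOf x) bounds)
    where
      bounds : List ℕ
      bounds = support g ∷ maxCtx Δ ∷ maxSc (nsubSc θ b) ∷ maxSc b' ∷ maxTy (nsubTy θ B) ∷ maxTy A ∷ maxSc u ∷ []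
      at : FreshName (sortOf x) bounds → Δ ⊢ Lam (sortOf x) b' ∶ all (sortOf x) (nsubTy θ B)
      at (fresh z ez (θ<z ∷ Δ<z ∷ b<z ∷ b'<z ∷ B<z ∷ A<z ∷ u<z ∷ [])) =
        ∀i-at z ez (>maxCtx⇒¬free Δ Δ<z) (¬occ-Lam ¬zb') (¬occ-all (>maxTy⇒¬occ _ B<z))
          (subst (Δ ⊢ instSc (nameAt z ez) b' ∶_) (rebind-openTy θ x z ez B θz (¬B ∘ all-body))
            (⊢-substIn d (admissible-⊙ g (admissible-↦ x (nameAt z ez)))
                         (⊙↦-fresh-ctx θ x _ (λ C → C ≡ A ⊎ C ∈ Δ) h ¬Γ) ⊢u
              (subst (λ t → SubstIn _ Δ t _) (sym (rebind-openSc θ x z ez b θz (¬b ∘ Lam-body))) r'')))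
        where
          open Swap y z (trans ey (sym ez))
          θz : θ z ≡ fv z
          θz = outside g z θ<z
          ¬zb' : ¬ OccSc z b'
          ¬zb' = >maxSc⇒¬occ b' b'<z
          r'' : SubstIn [ (A , u) ] Δ (instSc (nameAt z ez) (nsubSc θ b)) (instSc (nameAt z ez) b')
          r'' = subst₂ (SubstIn _ Δ) (π-instSc ey ez _ (¬yb ∘ Lam-body) (>maxSc⇒¬occ _ b<z))
                                     (π-instSc ey ez b' (¬yb' ∘ Lam-body) ¬zb')
                  (SubstIn-π-fixed (¬yσ ∘ here ∘ inj₁) (>maxTy⇒¬occ A A<z)
                                   (¬yσ ∘ here ∘ inj₂) (>maxSc⇒¬occ u u<z) r')

  ⊢-β⇒ : ∀ {Δ A B C t u v} → Δ ⊢ lam C t ∶ A ⇒ B → Δ ⊢ u ∶ A →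
         SubstIn [ (C , u) ] Δ t v → Δ ⊢ v ∶ B
  ⊢-β⇒ {Δ} {C = C} {t} d ⊢u r with ⊢lam⁻¹ d
  ... | B' , d' , C⇒B'≈A⇒B with imp-inv C⇒B'≈A⇒B
  ... | C≈A , B'≈B =
    conv (subst (Δ ⊢ _ ∶_) (nsubTy-id B')
           (⊢-substIn d' admissible-id h (conv ⊢u (sym≈ C≈A))
                      (subst (λ t → SubstIn _ Δ t _) (sym (nsubSc-id t)) r)))
         B'≈B
    where
      h : ∀ {D} → D ∈ C ∷ Δ → nsubTy idₙ D ≡ C ⊎ nsubTy idₙ D ∈ Δ
      h (here refl) = inj₁ (nsubTy-id C)
      h (there D∈Δ) = inj₂ (subst (_∈ Δ) (sym (nsubTy-id _)) D∈Δ)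

  ⊢-▷-nsub : ∀ {Γ t A} → Γ ⊢ t ∶ A → ∀ {θ Δ t'} → Admissible θ → (∀ {C} → C ∈ Γ → nsubTy θ C ∈ Δ) →
             Δ ⊢ nsubSc θ t ▷ t' → Δ ⊢ t' ∶ nsubTy θ A
  ⊢-▷-nsub (ax _) g h (top ())
  ⊢-▷-nsub (⇒i d) g h (top ())
  ⊢-▷-nsub (⇒i d) g h (lamC r)                        = ⇒i (⊢-▷-nsub d g (∷-mono h) r)
  ⊢-▷-nsub (⇒e d d') g h (appL r)                     = ⇒e (⊢-▷-nsub d g h r) (⊢-nsub d' g h)
  ⊢-▷-nsub (⇒e d d') g h (appR r)                     = ⇒e (⊢-nsub d g h) (⊢-▷-nsub d' g h r)
  ⊢-▷-nsub (⇒e {t = lam C t} d d') g h (top (β⇒ r))   = ⊢-β⇒ (⊢-nsub d g h) (⊢-nsub d' g h) r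
  ⊢-▷-nsub (∀e {B = B} d a) {θ} {Δ} g h (tappL r)     =
    subst (Δ ⊢ _ ∶_) (sym (nsubTy-instTy θ a B)) (∀e (⊢-▷-nsub d g h r) (nsubTm θ a))
  ⊢-▷-nsub (∀e {t = Lam s b} {B} d a) {θ} {Δ} g h (top β∀) =
    subst (Δ ⊢ _ ∶_) (sym (nsubTy-instTy θ a B)) (⊢Lam-inst (⊢-nsub d g h) (nsubTm θ a))
  ⊢-▷-nsub (conv d A≈B) g h r                         = conv (⊢-▷-nsub d g h r) (pres-≈ g A≈B)
  ⊢-▷-nsub (∀i x {b} {B} ¬Γ ¬b ¬B d) {θ} {Δ} g h r with Lam▷⁻¹ r
  ... | binder y ey {b'} ¬yΔ ¬yb ¬yb' r' = at (freshName (sortOf x) bounds)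
    where
      bounds : List ℕ
      bounds = support g ∷ maxCtx Δ ∷ maxSc (nsubSc θ b) ∷ maxSc b' ∷ maxTy (nsubTy θ B) ∷ []
      at : FreshName (sortOf x) bounds → Δ ⊢ Lam (sortOf x) b' ∶ all (sortOf x) (nsubTy θ B)
      at (fresh z ez (θ<z ∷ Δ<z ∷ b<z ∷ b'<z ∷ B<z ∷ [])) =
        ∀i-at z ez ¬zΔ (¬occ-Lam ¬zb') (¬occ-all (>maxTy⇒¬occ _ B<z))
          (subst (Δ ⊢ instSc (nameAt z ez) b' ∶_) (rebind-openTy θ x z ez B θz (¬B ∘ all-body))
            (⊢-▷-nsub d (admissible-⊙ g (admissible-↦ x (nameAt z ez))) (⊙↦-fresh-ctx θ x _ (_∈ Δ) h ¬Γ)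
              (subst (Δ ⊢_▷ _) (sym (rebind-openSc θ x z ez b θz (¬b ∘ Lam-body))) r'')))
        where
          open Swap y z (trans ey (sym ez))
          θz : θ z ≡ fv z
          θz = outside g z θ<z
          ¬zΔ : ¬ FreeIn z Δ
          ¬zΔ = >maxCtx⇒¬free Δ Δ<z
          ¬zb' : ¬ OccSc z b'
          ¬zb' = >maxSc⇒¬occ b' b'<z
          r'' : Δ ⊢ instSc (nameAt z ez) (nsubSc θ b) ▷ instSc (nameAt z ez) b'
          r'' = subst₂ (Δ ⊢_▷_) (π-instSc ey ez _ (¬yb ∘ Lam-body) (>maxSc⇒¬occ _ b<z))
                                (π-instSc ey ez b' (¬yb' ∘ Lam-body) ¬zb')
                  (▷-π-fixed ¬yΔ ¬zΔ r')

  ⊢-▷ : ∀ {Γ t t' A} → Γ ⊢ t ∶ A → Γ ⊢ t ▷ t' → Γ ⊢ t' ∶ A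
  ⊢-▷ {Γ} {t} {t'} {A} d r =
    subst (Γ ⊢ t' ∶_) (nsubTy-id A)
      (⊢-▷-nsub d admissible-id (λ {C} C∈Γ → subst (_∈ Γ) (sym (nsubTy-id C)) C∈Γ)
        (subst (Γ ⊢_▷ t') (sym (nsubSc-id t)) r))

  ⊢-▷* : ∀ {Γ t u A} → Γ ⊢ t ∶ A → Γ ⊢ t ▷* u → Γ ⊢ u ∶ A
  ⊢-▷* d ε        = d
  ⊢-▷* d (r ◅ rs) = ⊢-▷* (⊢-▷ d r) rs

theorem1 : (L : Language) → let open Lang L in
    (_≈_ : Prop → Prop → Set) → IsCongruence _≈_ → NonConfusing _≈_ →
    (Γ : Context) (A : Prop) (t u : Sch) →
    Typing._⊢_∶_ _≈_ Γ t A → Γ ⊢ t ▷* u → Typing._⊢_∶_ _≈_ Γ u A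
theorem1 L _≈_ cg nc Γ A t u = Typed.⊢-▷* L _≈_ cg nc
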